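{- Let $m\ge 4$ be even and let $(f_0,f_1,f_2)$ be the coloring defined below. Then $f_0$ and $f_1$ are each a single cycle of length $m^3$ on $V$, while $f_2$ decomposes into exactly $m+2$ disjoint directed cycles.
   Context: $V=(\mathbb Z_m)^3$ with points $v=(i,j,k)$; $S(v)=i+j+k\pmod m$; $\mathrm{bump}_i(i,j,k)=(i+1,j,k)$, $\mathrm{bump}_j(i,j,k)=(i,j+1,k)$, $\mathrm{bump}_k(i,j,k)=(i,j,k+1)$ mod $m$. The coloring is: $f_0(v)=\mathrm{bump}_j(v)$ if $S=0,k\ne0$; $\mathrm{bump}_k(v)$ if $S=1$; $\mathrm{bump}_i(v)$ otherwise. $f_1(v)=\mathrm{bump}_k(v)$ if $S=0$; $\mathrm{bump}_i(v)$ if $S=1,k=0$; $\mathrm{bump}_j(v)$ otherwise. $f_2(v)=\mathrm{bump}_j(v)$ if $S\in\{0,1\},k=0$; $\mathrm{bump}_i(v)$ if $S\in\{0,1\},k\ne0$; $\mathrm{bump}_k(v)$ otherwise. Each $f_c$ is a permutation of $V$. -}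

module Defs where

open import Data.Nat using (ℕ; zero; suc; _+_; _*_; _≤_; _<_; NonZero; _≟_)
open import Data.Nat.DivMod using (_%_; m%n<n)
open import Data.Fin using (Fin; toℕ; fromℕ<)
open import Data.Product using (_×_; _,_; ∃)
open import Relation.Binary.PropositionalEquality using (_≡_)
open import Relation.Nullary using (¬_; yes; no)
open import Function using (id; _∘_)

V : ℕ → Set
V m = Fin m × Fin m × Fin m

incMod : (m : ℕ) → .{{_ : NonZero m}} → Fin m → Fin m
incMod m x = fromℕ< (m%n<n (suc (toℕ x)) m)

module _ (m : ℕ) .{{_ : NonZero m}} where

  S : V m → ℕ
  S (i , j , k) = (toℕ i + toℕ j + toℕ k) % m

  bumpᵢ bumpⱼ bumpₖ : V m → V m
  bumpᵢ (i , j , k) = (incMod m i , j , k)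
  bumpⱼ (i , j , k) = (i , incMod m j , k)
  bumpₖ (i , j , k) = (i , j , incMod m k)

  f₀ : V m → V m
  f₀ v@(i , j , k) with S v | toℕ k
  ... | 0 | suc _ = bumpⱼ v
  ... | 0 | 0 = bumpᵢ v
  ... | 1 | _ = bumpₖ v
  ... | _ | _ = bumpᵢ v

  f₁ : V m → V m
  f₁ v@(i , j , k) with S v | toℕ k
  ... | 0 | _ = bumpₖ v
  ... | 1 | 0 = bumpᵢ v
  ... | _ | _ = bumpⱼ v

  f₂ : V m → V m
  f₂ v@(i , j , k) with S v | toℕ k
  ... | 0 | 0 = bumpⱼ v
  ... | 1 | 0 = bumpⱼ v
  ... | 0 | suc _ = bumpᵢ v
  ... | 1 | suc _ = bumpᵢ v
  ... | _ | _ = bumpₖ v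

iter : {A : Set} → (A → A) → ℕ → A → A
iter f zero = id
iter f (suc n) = f ∘ iter f n

SameCycle : {A : Set} → (A → A) → A → A → Set
SameCycle f v w = ∃ λ n → iter f n v ≡ w

HasCycleCount : {A : Set} → (A → A) → ℕ → Set
HasCycleCount {A} f k =
  ∃ λ (rep : Fin k → A) →
    ((a b : Fin k) → SameCycle f (rep a) (rep b) → a ≡ b)
    × ((v : A) → ∃ λ a → SameCycle f (rep a) v)

-- Each colour map moves a point to a neighbour whose level S is one higher, so every
-- cycle of f meets the layer S = 0, two points of that layer lie on the same cycle of f
-- iff they lie on the same orbit of the return map R = f^m, and every point is reached
-- from the layer (f is onto, with explicit predecessors). In coordinates (S, i, k) the
-- return maps are piecewise translations of (i, k). For f₀, R adds (-2, 1), or (-1, 1)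
-- when k = 0, so m rounds add 1 to i and R is one m²-cycle; f₁ is an odometer, adding
-- (0, 1), or (1, 1) when k + 1 = 0. For f₂, R adds (2, -2), or (0, -2) when k = 0. As m
-- is even, odd k never reaches 0, so i + k is invariant there and gives m orbits, while
-- for even k the parity of i is invariant and each parity is a single orbit: m + 2 cycles.
module Submission where

open import Defs
open import Data.Nat using (ℕ; zero; suc; _+_; _*_; _≤_; _<_; NonZero; s≤s; s≤s⁻¹; _≟_)
open import Data.Nat.Properties
open import Data.Nat.DivMod
open import Data.Nat.Divisibility using (_∣_; divides)
open import Data.Nat.Tactic.RingSolver using (solve-∀)
open import Data.Fin using (Fin; toℕ; splitAt; _↑ˡ_; _↑ʳ_)
import Data.Fin as Fin
open import Data.Fin.Properties
  using (toℕ-injective; toℕ-fromℕ<; toℕ<n; toℕ-↑ˡ; toℕ-↑ʳ; splitAt-↑ˡ; splitAt-↑ʳ; splitAt⁻¹-↑ˡ; splitAt⁻¹-↑ʳ)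
open import Data.Product using (_×_; _,_; ∃; proj₁; proj₂)
open import Data.Sum using (_⊎_; inj₁; inj₂; [_,_]′)
open import Function using (_∘_)
open import Relation.Binary.PropositionalEquality hiding (J)
open import Relation.Nullary using (contradiction; yes; no)

iter-comm : ∀ {A : Set} (f : A → A) t x → iter f t (f x) ≡ f (iter f t x)
iter-comm f zero    x = refl
iter-comm f (suc t) x = cong f (iter-comm f t x)

module _ {A : Set} (f : A → A) where

  iter-+ : ∀ s t x → iter f (s + t) x ≡ iter f t (iter f s x)
  iter-+ zero    t x = refl
  iter-+ (suc s) t x = trans (cong f (iter-+ s t x)) (sym (iter-comm f t (iter f s x)))

  iter-* : ∀ q t x → iter f (q * t) x ≡ iter (iter f t) q x
  iter-* zero    t x = refl
  iter-* (suc q) t x = begin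
    iter f (t + q * t) x             ≡⟨ iter-+ t (q * t) x ⟩
    iter f (q * t) (iter f t x)      ≡⟨ iter-* q t (iter f t x) ⟩
    iter (iter f t) q (iter f t x)   ≡⟨ iter-comm (iter f t) q x ⟩
    iter f t (iter (iter f t) q x)   ∎
    where open ≡-Reasoning

  iter-along : (g : ℕ → A) (r : ℕ) → (∀ {u} → u < r → f (g u) ≡ g (suc u)) →
               iter f r (g 0) ≡ g r
  iter-along g zero    step = refl
  iter-along g (suc r) step =
    trans (cong f (iter-along g r (λ u<r → step (m<n⇒m<1+n u<r)))) (step ≤-refl)

  sameCycle-trans : ∀ {x y z} → SameCycle f x y → SameCycle f y z → SameCycle f x z
  sameCycle-trans {x} (s , refl) (t , refl) = s + t , iter-+ s t x

  sameCycle-cong : ∀ {h} → (∀ x → f x ≡ h x) → ∀ {x y} → SameCycle f x y → SameCycle h x y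
  sameCycle-cong {h} f≗h {x} (t , refl) = t , sym (iter-cong t)
    where
    iter-cong : ∀ t → iter f t x ≡ iter h t x
    iter-cong zero    = refl
    iter-cong (suc t) = trans (f≗h _) (cong h (iter-cong t))

  sameCycle-iter : ∀ t {x y} → SameCycle (iter f t) x y → SameCycle f x y
  sameCycle-iter t {x} (q , refl) = q * t , iter-* q t x

module Modular (m : ℕ) .{{_ : NonZero m}} where

  -- A data type rather than x % m ≡ y % m so that x and y can be inferred.
  infix 4 _≡ₘ_
  data _≡ₘ_ (x y : ℕ) : Set where
    mod-≡ : x % m ≡ y % m → x ≡ₘ y

  %-≡ : ∀ {x y} → x ≡ₘ y → x % m ≡ y % m
  %-≡ (mod-≡ eq) = eq

  ≡ₘ-reflexive : ∀ {x y} → x ≡ y → x ≡ₘ y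
  ≡ₘ-reflexive refl = mod-≡ refl

  ≡ₘ-refl : ∀ {x} → x ≡ₘ x
  ≡ₘ-refl = mod-≡ refl

  ≡ₘ-sym : ∀ {x y} → x ≡ₘ y → y ≡ₘ x
  ≡ₘ-sym (mod-≡ eq) = mod-≡ (sym eq)

  ≡ₘ-trans : ∀ {x y z} → x ≡ₘ y → y ≡ₘ z → x ≡ₘ z
  ≡ₘ-trans (mod-≡ eq) (mod-≡ eq′) = mod-≡ (trans eq eq′)

  +-cong-≡ₘ : ∀ {a a′ b b′} → a ≡ₘ a′ → b ≡ₘ b′ → a + b ≡ₘ a′ + b′
  +-cong-≡ₘ {a} {a′} {b} {b′} (mod-≡ a≡) (mod-≡ b≡) = mod-≡ (begin
    (a + b) % m             ≡⟨ %-distribˡ-+ a b m ⟩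
    (a % m + b % m) % m     ≡⟨ cong₂ (λ x y → (x + y) % m) a≡ b≡ ⟩
    (a′ % m + b′ % m) % m   ≡⟨ %-distribˡ-+ a′ b′ m ⟨
    (a′ + b′) % m           ∎)
    where open ≡-Reasoning

  *-congˡ-≡ₘ : ∀ k {a a′} → a ≡ₘ a′ → k * a ≡ₘ k * a′
  *-congˡ-≡ₘ k {a} {a′} (mod-≡ a≡) = mod-≡ (begin
    (k * a) % m             ≡⟨ %-distribˡ-* k a m ⟩
    (k % m * (a % m)) % m   ≡⟨ cong (λ x → (k % m * x) % m) a≡ ⟩
    (k % m * (a′ % m)) % m  ≡⟨ %-distribˡ-* k a′ m ⟨
    (k * a′) % m            ∎)
    where open ≡-Reasoning

  %-≡ₘ : ∀ x → x % m ≡ₘ x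
  %-≡ₘ x = mod-≡ (m%n%n≡m%n x m)

  multiple-≡ₘ : ∀ {x y} k → x ≡ y + k * m → x ≡ₘ y
  multiple-≡ₘ {y = y} k refl = mod-≡ ([m+kn]%n≡m%n y k m)

  suc-%-≢0 : ∀ {x} → suc x < m → suc x % m ≢ 0
  suc-%-≢0 x<m eq = 0≢1+n (trans (sym eq) (m<n⇒m%n≡m x<m))

  ≡ₘ-value : ∀ {x y} → x ≡ₘ y → y < m → x % m ≡ y
  ≡ₘ-value (mod-≡ eq) y<m = trans eq (m<n⇒m%n≡m y<m)

  toℕ-mod : ∀ x → toℕ (x mod m) ≡ x % m
  toℕ-mod x = toℕ-fromℕ< (m%n<n x m)

  mod-cong : ∀ {x y} → x ≡ₘ y → x mod m ≡ y mod m
  mod-cong {x} {y} (mod-≡ x≡y) = toℕ-injective (trans (toℕ-mod x) (trans x≡y (sym (toℕ-mod y))))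

  toℕ-mod-toℕ : (i : Fin m) → toℕ i mod m ≡ i
  toℕ-mod-toℕ i = toℕ-injective (trans (toℕ-mod (toℕ i)) (m<n⇒m%n≡m (toℕ<n i)))

module Graded {A : Set} (m : ℕ) .{{_ : NonZero m}}
               (level : A → ℕ) (level<m : ∀ x → level x < m)
               (f : A → A) (level-f : ∀ x → level (f x) ≡ suc (level x) % m) where

  open ≡-Reasoning
  open Modular m

  level-iter : ∀ t x → level (iter f t x) ≡ (level x + t) % m
  level-iter zero    x = trans (sym (m<n⇒m%n≡m (level<m x))) (cong (_% m) (sym (+-identityʳ _)))
  level-iter (suc t) x = begin
    level (f (iter f t x))        ≡⟨ level-f (iter f t x) ⟩
    suc (level (iter f t x)) % m  ≡⟨ cong (λ l → suc l % m) (level-iter t x) ⟩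
    (1 + (level x + t) % m) % m   ≡⟨ %-≡ (+-cong-≡ₘ (≡ₘ-refl {1}) (%-≡ₘ (level x + t))) ⟩
    suc (level x + t) % m         ≡⟨ cong (_% m) (+-suc (level x) t) ⟨
    (level x + suc t) % m         ∎

  iter-return-level : ∀ q x → level x ≡ 0 → level (iter (iter f m) q x) ≡ 0
  iter-return-level zero    x lx = lx
  iter-return-level (suc q) x lx = begin
    level (iter f m (iter (iter f m) q x))     ≡⟨ level-iter m _ ⟩
    (level (iter (iter f m) q x) + m) % m      ≡⟨ cong (λ l → (l + m) % m) (iter-return-level q x lx) ⟩
    m % m                                      ≡⟨ n%n≡0 m ⟩
    0                                          ∎

  sameCycle⇒return : ∀ {x y} → level x ≡ 0 → level y ≡ 0 →
                     SameCycle f x y → SameCycle (iter f m) x y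
  sameCycle⇒return {x} lx ly (t , refl) = t / m , (begin
      iter (iter f m) (t / m) x  ≡⟨ iter-* f (t / m) m x ⟨
      iter f (t / m * m) x       ≡⟨ cong (λ s → iter f s x) t/m*m≡t ⟩
      iter f t x                 ∎)
    where
    t%m≡0 : t % m ≡ 0
    t%m≡0 = begin
      t % m                ≡⟨ cong (λ l → (l + t) % m) lx ⟨
      (level x + t) % m    ≡⟨ level-iter t x ⟨
      level (iter f t x)   ≡⟨ ly ⟩
      0                    ∎
    t/m*m≡t : t / m * m ≡ t
    t/m*m≡t = sym (trans (m≡m%n+[m/n]*n t m) (cong (_+ t / m * m) t%m≡0))

  index-invariant : (index : A → ℕ) →
                    (∀ v → level v ≡ 0 → index (iter f m v) ≡ index v) →
                    ∀ {x y} → level x ≡ 0 → SameCycle (iter f m) x y → index y ≡ index x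
  index-invariant index invariant {x} lx (q , refl) = along q
    where
    along : ∀ q → index (iter (iter f m) q x) ≡ index x
    along zero    = refl
    along (suc q) = trans (invariant _ (iter-return-level q x lx)) (along q)

  Predecessors : Set
  Predecessors = ∀ s v → level v ≡ suc s → ∃ λ u → level u ≡ s × f u ≡ v

  from-level0 : Predecessors → ∀ v → ∃ λ u → level u ≡ 0 × SameCycle f u v
  from-level0 pred v = descend (level v) v refl
    where
    descend : ∀ s v → level v ≡ s → ∃ λ u → level u ≡ 0 × SameCycle f u v
    descend zero    v lv = v , lv , 0 , refl
    descend (suc s) v lv =
      let (u , lu , fu≡v) = pred s v lv
          (w , lw , w→u)  = descend s u lu
      in  w , lw , sameCycle-trans f w→u (1 , fu≡v)

  hasCycleCount : ∀ {N} (rep : Fin N → A) (index : A → ℕ) →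
                  (∀ a → level (rep a) ≡ 0) → (∀ a → index (rep a) ≡ toℕ a) →
                  (∀ v → level v ≡ 0 → index (iter f m v) ≡ index v) →
                  Predecessors →
                  (∀ v → level v ≡ 0 → ∃ λ a → SameCycle (iter f m) (rep a) v) →
                  HasCycleCount f N
  hasCycleCount rep index rep-level rep-index invariant pred reach = rep , distinct , cover
    where
    distinct : ∀ a b → SameCycle f (rep a) (rep b) → a ≡ b
    distinct a b same = toℕ-injective (begin
      toℕ a          ≡⟨ rep-index a ⟨
      index (rep a)  ≡⟨ index-invariant index invariant (rep-level a)
                          (sameCycle⇒return (rep-level a) (rep-level b) same) ⟨
      index (rep b)  ≡⟨ rep-index b ⟩
      toℕ b          ∎)

    cover : ∀ v → ∃ λ a → SameCycle f (rep a) v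
    cover v =
      let (u , lu , u→v) = from-level0 pred v
          (a , rep→u)    = reach u lu
      in  a , sameCycle-trans f (sameCycle-iter f m rep→u) u→v

  hasOneCycle : (x : A) → level x ≡ 0 → Predecessors →
                (∀ v → level v ≡ 0 → SameCycle (iter f m) x v) → HasCycleCount f 1
  hasOneCycle x lx pred reach =
    hasCycleCount (λ _ → x) (λ _ → 0) (λ _ → lx) (λ { Fin.zero → refl ; (Fin.suc ()) }) (λ _ _ → refl)
                  pred
                  (λ v lv → Fin.zero , reach v lv)

data Axis : Set where
  I J K : Axis

-- The axis along which a colour map moves v, as a function of S v and toℕ k.
Rule : Set
Rule = ℕ → ℕ → Axis

UniformInK : Rule → Set
UniformInK ρ = ∀ s c c′ → ρ s c ≡ K → ρ s c′ ≡ K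

ρ₀ ρ₁ ρ₂ : Rule
ρ₀ 0 zero          = I
ρ₀ 0 (suc _)       = J
ρ₀ 1 _             = K
ρ₀ (suc (suc _)) _ = I

ρ₁ 0 _             = K
ρ₁ 1 zero          = I
ρ₁ 1 (suc _)       = J
ρ₁ (suc (suc _)) _ = J

ρ₂ 0 zero          = J
ρ₂ 0 (suc _)       = I
ρ₂ 1 zero          = J
ρ₂ 1 (suc _)       = I
ρ₂ (suc (suc _)) _ = K

uniform₀ : UniformInK ρ₀
uniform₀ 0 zero          _ ()
uniform₀ 0 (suc _)       _ ()
uniform₀ 1 _             _ _  = refl
uniform₀ (suc (suc _)) _ _ ()

uniform₁ : UniformInK ρ₁
uniform₁ 0 _             _ _  = refl
uniform₁ 1 zero          _ ()
uniform₁ 1 (suc _)       _ ()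
uniform₁ (suc (suc _)) _ _ ()

uniform₂ : UniformInK ρ₂
uniform₂ 0 zero          _ ()
uniform₂ 0 (suc _)       _ ()
uniform₂ 1 zero          _ ()
uniform₂ 1 (suc _)       _ ()
uniform₂ (suc (suc _)) _ _ _ = refl

nonzero-case : ∀ {A : Set} (g : ℕ → A) {x} → (∀ κ → g (suc κ) ≡ x) → ∀ {κ} → κ ≢ 0 → g κ ≡ x
nonzero-case g g≡x {zero}  κ≢0 = contradiction refl κ≢0
nonzero-case g g≡x {suc κ} _   = g≡x κ

module Torus (n : ℕ) where

  open ≡-Reasoning

  m : ℕ
  m = suc (suc n)

  open Modular m public

  -- The point with S = t, i = a, k = c (mod m); its j-coordinate t - a - c is written
  -- t + (m - 1)(a + c) to stay in ℕ. Opaque, so that t, a, c can be inferred from it.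
  opaque
    ⟪_,_,_⟫ : ℕ → ℕ → ℕ → V m
    ⟪ t , a , c ⟫ = a mod m , (t + suc n * (a + c)) mod m , c mod m

  coordᵢ coordₖ : V m → Fin m
  coordᵢ (i , _ , _) = i
  coordₖ (_ , _ , k) = k

  S<m : ∀ v → S m v < m
  S<m (i , j , k) = m%n<n (toℕ i + toℕ j + toℕ k) m

  m+-≡ₘ : ∀ x → m + x ≡ₘ x
  m+-≡ₘ x = multiple-≡ₘ 1 (trans (+-comm m x) (cong (x +_) (sym (*-identityˡ m))))

  +m-≡ₘ : ∀ x → x + m ≡ₘ x
  +m-≡ₘ x = multiple-≡ₘ 1 (cong (x +_) (sym (*-identityˡ m)))

  opaque
    unfolding ⟪_,_,_⟫

    ⟪⟫-cong : ∀ {t t′ a a′ c c′} → t ≡ₘ t′ → a ≡ₘ a′ → c ≡ₘ c′ → ⟪ t , a , c ⟫ ≡ ⟪ t′ , a′ , c′ ⟫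
    ⟪⟫-cong t≡ a≡ c≡ =
      cong₂ _,_ (mod-cong a≡)
        (cong₂ _,_ (mod-cong (+-cong-≡ₘ t≡ (*-congˡ-≡ₘ (suc n) (+-cong-≡ₘ a≡ c≡)))) (mod-cong c≡))

    S-⟪⟫ : ∀ t a c → S m ⟪ t , a , c ⟫ ≡ t % m
    S-⟪⟫ t a c = begin
      (toℕ (a mod m) + toℕ (j mod m) + toℕ (c mod m)) % m
        ≡⟨ cong₂ (λ x y → (x + y) % m) (cong₂ _+_ (toℕ-mod a) (toℕ-mod j)) (toℕ-mod c) ⟩
      (a % m + j % m + c % m) % m
        ≡⟨ %-≡ (+-cong-≡ₘ (+-cong-≡ₘ (%-≡ₘ a) (%-≡ₘ j)) (%-≡ₘ c)) ⟩
      (a + j + c) % m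
        ≡⟨ %-≡ (multiple-≡ₘ (a + c) (identity a c t n)) ⟩
      t % m ∎
      where
      j : ℕ
      j = t + suc n * (a + c)
      identity : ∀ a c t n → a + (t + suc n * (a + c)) + c ≡ t + (a + c) * suc (suc n)
      identity = solve-∀

    ⟪⟫-toℕ : ∀ i j k → ⟪ S m (i , j , k) , toℕ i , toℕ k ⟫ ≡ (i , j , k)
    ⟪⟫-toℕ i j k =
      cong₂ _,_ (toℕ-mod-toℕ i) (cong₂ _,_ (trans (mod-cong j≡) (toℕ-mod-toℕ j)) (toℕ-mod-toℕ k))
      where
      identity : ∀ a b c n → a + b + c + suc n * (a + c) ≡ b + (a + c) * suc (suc n)
      identity = solve-∀
      j≡ : (toℕ i + toℕ j + toℕ k) % m + suc n * (toℕ i + toℕ k) ≡ₘ toℕ j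
      j≡ = ≡ₘ-trans (+-cong-≡ₘ (%-≡ₘ (toℕ i + toℕ j + toℕ k)) ≡ₘ-refl)
                    (multiple-≡ₘ (toℕ i + toℕ k) (identity (toℕ i) (toℕ j) (toℕ k) n))

    coordᵢ-⟪⟫ : ∀ t a c → coordᵢ ⟪ t , a , c ⟫ ≡ a mod m
    coordᵢ-⟪⟫ t a c = refl

    coordₖ-⟪⟫ : ∀ t a c → coordₖ ⟪ t , a , c ⟫ ≡ c mod m
    coordₖ-⟪⟫ t a c = refl

    incMod-mod : ∀ x → incMod m (x mod m) ≡ suc x mod m
    incMod-mod x = mod-cong (≡ₘ-trans (≡ₘ-reflexive (cong suc (toℕ-mod x)))
                                      (+-cong-≡ₘ (≡ₘ-refl {1}) (%-≡ₘ x)))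

    bumpᵢ-⟪⟫ : ∀ t a c → bumpᵢ m ⟪ t , a , c ⟫ ≡ ⟪ suc t , suc a , c ⟫
    bumpᵢ-⟪⟫ t a c =
      cong₂ _,_ (incMod-mod a) (cong (_, c mod m) (mod-cong (≡ₘ-sym (multiple-≡ₘ 1 (identity t a c n)))))
      where
      identity : ∀ t a c n → suc t + suc n * (suc a + c) ≡ t + suc n * (a + c) + 1 * suc (suc n)
      identity = solve-∀

    bumpⱼ-⟪⟫ : ∀ t a c → bumpⱼ m ⟪ t , a , c ⟫ ≡ ⟪ suc t , a , c ⟫
    bumpⱼ-⟪⟫ t a c = cong (λ y → a mod m , y , c mod m) (incMod-mod (t + suc n * (a + c)))

    bumpₖ-⟪⟫ : ∀ t a c → bumpₖ m ⟪ t , a , c ⟫ ≡ ⟪ suc t , a , suc c ⟫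
    bumpₖ-⟪⟫ t a c =
      cong (a mod m ,_) (cong₂ _,_ (mod-cong (≡ₘ-sym (multiple-≡ₘ 1 (identity t a c n)))) (incMod-mod c))
      where
      identity : ∀ t a c n → suc t + suc n * (a + suc c) ≡ t + suc n * (a + c) + 1 * suc (suc n)
      identity = solve-∀

  bump : Axis → V m → V m
  bump I = bumpᵢ m
  bump J = bumpⱼ m
  bump K = bumpₖ m

  iter-bumpᵢ : ∀ r t a c → iter (bump I) r ⟪ t , a , c ⟫ ≡ ⟪ r + t , r + a , c ⟫
  iter-bumpᵢ r t a c = iter-along (bump I) (λ r → ⟪ r + t , r + a , c ⟫) r (λ _ → bumpᵢ-⟪⟫ _ _ c)

  iter-bumpⱼ : ∀ r t a c → iter (bump J) r ⟪ t , a , c ⟫ ≡ ⟪ r + t , a , c ⟫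
  iter-bumpⱼ r t a c = iter-along (bump J) (λ r → ⟪ r + t , a , c ⟫) r (λ _ → bumpⱼ-⟪⟫ _ a c)

  iter-bumpₖ : ∀ r t a c → iter (bump K) r ⟪ t , a , c ⟫ ≡ ⟪ r + t , a , r + c ⟫
  iter-bumpₖ r t a c = iter-along (bump K) (λ r → ⟪ r + t , a , r + c ⟫) r (λ _ → bumpₖ-⟪⟫ _ a _)

  S-bump : ∀ d v → S m (bump d v) ≡ suc (S m v) % m
  S-bump d (i , j , k) = begin
    S m (bump d (i , j , k))    ≡⟨ cong (S m ∘ bump d) (⟪⟫-toℕ i j k) ⟨
    S m (bump d ⟪ s , a , c ⟫)  ≡⟨ S-bump-⟪⟫ d ⟩
    suc s % m                   ∎
    where
    s a c : ℕ
    s = S m (i , j , k)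
    a = toℕ i
    c = toℕ k
    S-bump-⟪⟫ : ∀ d → S m (bump d ⟪ s , a , c ⟫) ≡ suc s % m
    S-bump-⟪⟫ I = trans (cong (S m) (bumpᵢ-⟪⟫ s a c)) (S-⟪⟫ _ _ _)
    S-bump-⟪⟫ J = trans (cong (S m) (bumpⱼ-⟪⟫ s a c)) (S-⟪⟫ _ _ _)
    S-bump-⟪⟫ K = trans (cong (S m) (bumpₖ-⟪⟫ s a c)) (S-⟪⟫ _ _ _)

  iter-bump-period : ∀ d v → iter (bump d) m v ≡ v
  iter-bump-period d (i , j , k) = begin
    iter (bump d) m (i , j , k)    ≡⟨ cong (iter (bump d) m) (⟪⟫-toℕ i j k) ⟨
    iter (bump d) m ⟪ s , a , c ⟫  ≡⟨ period d ⟩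
    ⟪ s , a , c ⟫                  ≡⟨ ⟪⟫-toℕ i j k ⟩
    (i , j , k)                    ∎
    where
    s a c : ℕ
    s = S m (i , j , k)
    a = toℕ i
    c = toℕ k
    period : ∀ d → iter (bump d) m ⟪ s , a , c ⟫ ≡ ⟪ s , a , c ⟫
    period I = trans (iter-bumpᵢ m s a c) (⟪⟫-cong (m+-≡ₘ s) (m+-≡ₘ a) ≡ₘ-refl)
    period J = trans (iter-bumpⱼ m s a c) (⟪⟫-cong (m+-≡ₘ s) ≡ₘ-refl ≡ₘ-refl)
    period K = trans (iter-bumpₖ m s a c) (⟪⟫-cong (m+-≡ₘ s) ≡ₘ-refl (m+-≡ₘ c))

  coordₖ-iter-bump : ∀ d → d ≢ K → ∀ t v → coordₖ (iter (bump d) t v) ≡ coordₖ v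
  coordₖ-iter-bump d d≢K zero    v = refl
  coordₖ-iter-bump d d≢K (suc t) v = trans (coordₖ-bump d d≢K _) (coordₖ-iter-bump d d≢K t v)
    where
    coordₖ-bump : ∀ d → d ≢ K → ∀ v → coordₖ (bump d v) ≡ coordₖ v
    coordₖ-bump I _   (i , j , k) = refl
    coordₖ-bump J _   (i , j , k) = refl
    coordₖ-bump K K≢K _           = contradiction refl K≢K

  S-iter-bump : ∀ d t v → S m (iter (bump d) t v) ≡ (S m v + t) % m
  S-iter-bump d = Graded.level-iter m (S m) S<m (bump d) (S-bump d)

  Follows : Rule → (V m → V m) → Set
  Follows ρ f = ∀ i j k → f (i , j , k) ≡ bump (ρ (S m (i , j , k)) (toℕ k)) (i , j , k)

  module FollowingRule {ρ : Rule} {f : V m → V m} (follows : Follows ρ f) where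

    follows-at : ∀ v → f v ≡ bump (ρ (S m v) (toℕ (coordₖ v))) v
    follows-at (i , j , k) = follows i j k

    step-⟪⟫ : ∀ {d} t a c → ρ (t % m) (c % m) ≡ d → f ⟪ t , a , c ⟫ ≡ bump d ⟪ t , a , c ⟫
    step-⟪⟫ {d} t a c ρ≡d = begin
      f ⟪ t , a , c ⟫                                          ≡⟨ follows-at ⟪ t , a , c ⟫ ⟩
      bump (ρ (S m ⟪ t , a , c ⟫) (toℕ (coordₖ ⟪ t , a , c ⟫))) ⟪ t , a , c ⟫
        ≡⟨ cong₂ (λ s κ → bump (ρ s κ) ⟪ t , a , c ⟫) (S-⟪⟫ t a c)
                 (trans (cong toℕ (coordₖ-⟪⟫ t a c)) (toℕ-mod c)) ⟩
      bump (ρ (t % m) (c % m)) ⟪ t , a , c ⟫                   ≡⟨ cong (λ d → bump d ⟪ t , a , c ⟫) ρ≡d ⟩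
      bump d ⟪ t , a , c ⟫                                     ∎

    stepᵢ : ∀ t a c → ρ (t % m) (c % m) ≡ I → f ⟪ t , a , c ⟫ ≡ ⟪ suc t , suc a , c ⟫
    stepᵢ t a c ρ≡I = trans (step-⟪⟫ t a c ρ≡I) (bumpᵢ-⟪⟫ t a c)

    stepⱼ : ∀ t a c → ρ (t % m) (c % m) ≡ J → f ⟪ t , a , c ⟫ ≡ ⟪ suc t , a , c ⟫
    stepⱼ t a c ρ≡J = trans (step-⟪⟫ t a c ρ≡J) (bumpⱼ-⟪⟫ t a c)

    stepₖ : ∀ t a c → ρ (t % m) (c % m) ≡ K → f ⟪ t , a , c ⟫ ≡ ⟪ suc t , a , suc c ⟫
    stepₖ t a c ρ≡K = trans (step-⟪⟫ t a c ρ≡K) (bumpₖ-⟪⟫ t a c)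

    S-f : ∀ v → S m (f v) ≡ suc (S m v) % m
    S-f v = trans (cong (S m) (follows-at v)) (S-bump (ρ (S m v) (toℕ (coordₖ v))) v)

    open Graded m (S m) S<m f S-f public

    -- u steps back from v along the axis ρ s (k of v); by UniformInK, ρ makes the same
    -- choice at u, so f u = v.
    predecessors : UniformInK ρ → Predecessors
    predecessors uniform s v Sv≡1+s = u , Su≡s , fu≡v
      where
      d : Axis
      d = ρ s (toℕ (coordₖ v))
      u : V m
      u = iter (bump d) (suc n) v
      identity : ∀ s n → suc s + suc n ≡ s + 1 * suc (suc n)
      identity = solve-∀
      Su≡s : S m u ≡ s
      Su≡s = begin
        S m u                ≡⟨ S-iter-bump d (suc n) v ⟩
        (S m v + suc n) % m  ≡⟨ cong (λ l → (l + suc n) % m) Sv≡1+s ⟩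
        (suc s + suc n) % m  ≡⟨ ≡ₘ-value (multiple-≡ₘ 1 (identity s n))
                                        (<-trans (n<1+n s) (subst (_< m) Sv≡1+s (S<m v))) ⟩
        s                    ∎
      same-axis : ∀ d′ → ρ s (toℕ (coordₖ v)) ≡ d′ →
                  ρ s (toℕ (coordₖ (iter (bump d′) (suc n) v))) ≡ d′
      same-axis I eq = trans (cong (ρ s ∘ toℕ) (coordₖ-iter-bump I (λ ()) (suc n) v)) eq
      same-axis J eq = trans (cong (ρ s ∘ toℕ) (coordₖ-iter-bump J (λ ()) (suc n) v)) eq
      same-axis K eq = uniform s _ _ eq
      fu≡v : f u ≡ v
      fu≡v = begin
        f u                                   ≡⟨ follows-at u ⟩
        bump (ρ (S m u) (toℕ (coordₖ u))) u   ≡⟨ cong (λ s′ → bump (ρ s′ (toℕ (coordₖ u))) u) Su≡s ⟩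
        bump (ρ s (toℕ (coordₖ u))) u         ≡⟨ cong (λ d′ → bump d′ u) (same-axis d refl) ⟩
        bump d u                              ≡⟨ iter-bump-period d v ⟩
        v                                     ∎

    round : ∀ {d} → (∀ s κ → ρ (2 + s) κ ≡ d) → ∀ v → S m v ≡ 0 →
            iter f m v ≡ iter (bump d) n (f (f v))
    round {d} above v Sv≡0 = run n ≤-refl
      where
      run : ∀ r → r ≤ n → iter f (2 + r) v ≡ iter (bump d) r (f (f v))
      run zero    _   = refl
      run (suc r) r<n = begin
        f x                                  ≡⟨ follows-at x ⟩
        bump (ρ (S m x) (toℕ (coordₖ x))) x  ≡⟨ cong (λ s → bump (ρ s (toℕ (coordₖ x))) x) Sx≡2+r ⟩
        bump (ρ (2 + r) (toℕ (coordₖ x))) x  ≡⟨ cong (λ d′ → bump d′ x) (above r _) ⟩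
        bump d x                             ≡⟨ cong (bump d) (run r (<⇒≤ r<n)) ⟩
        bump d (iter (bump d) r (f (f v)))   ∎
        where
        x : V m
        x = iter f (2 + r) v
        Sx≡2+r : S m x ≡ 2 + r
        Sx≡2+r = begin
          S m x                    ≡⟨ level-iter (2 + r) v ⟩
          (S m v + (2 + r)) % m    ≡⟨ cong (λ l → (l + (2 + r)) % m) Sv≡0 ⟩
          (2 + r) % m              ≡⟨ m<n⇒m%n≡m (s≤s (s≤s r<n)) ⟩
          2 + r                    ∎

  follows₀ : Follows ρ₀ (f₀ m)
  follows₀ i j k with S m (i , j , k)
  ... | 0 with toℕ k
  ...   | zero  = refl
  ...   | suc _ = refl
  follows₀ i j k | 1           = refl
  follows₀ i j k | suc (suc _) = refl

  follows₁ : Follows ρ₁ (f₁ m)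
  follows₁ i j k with S m (i , j , k)
  ... | 0 = refl
  ... | 1 with toℕ k
  ...   | zero  = refl
  ...   | suc _ = refl
  follows₁ i j k | suc (suc _) = refl

  follows₂ : Follows ρ₂ (f₂ m)
  follows₂ i j k with S m (i , j , k)
  ... | 0 with toℕ k
  ...   | zero  = refl
  ...   | suc _ = refl
  follows₂ i j k | 1 with toℕ k
  ...   | zero  = refl
  ...   | suc _ = refl
  follows₂ i j k | suc (suc _) = refl

  n+2≡ₘ0 : n + 2 ≡ₘ 0
  n+2≡ₘ0 = multiple-≡ₘ 1 (trans (+-comm n 2) (sym (*-identityˡ m)))

  level0-ind : (P : V m → Set) → (∀ a c → c < m → P ⟪ 0 , a , c ⟫) → ∀ v → S m v ≡ 0 → P v
  level0-ind P P⟪⟫ (i , j , k) Sv≡0 =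
    subst P (trans (cong (λ s → ⟪ s , toℕ i , toℕ k ⟫) (sym Sv≡0)) (⟪⟫-toℕ i j k))
            (P⟪⟫ (toℕ i) (toℕ k) (toℕ<n k))

  pred-≡ₘ : ∀ c → c < m → ∃ λ r → r < m × suc r ≡ₘ c
  pred-≡ₘ zero    _           = suc n , ≤-refl , mod-≡ (n%n≡0 m)
  pred-≡ₘ (suc c) (s≤s c<1+n) = c , m<n⇒m<1+n c<1+n , ≡ₘ-refl

  module F₀ = FollowingRule {ρ₀} {f₀ m} follows₀

  R₀ : V m → V m
  R₀ = iter (f₀ m) m

  f₀-round-k≢0 : ∀ a c → c % m ≢ 0 → R₀ ⟪ 0 , a , c ⟫ ≡ ⟪ 0 , n + a , suc c ⟫
  f₀-round-k≢0 a c c≢0 = begin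
    R₀ ⟪ 0 , a , c ⟫                             ≡⟨ F₀.round (λ _ _ → refl) ⟪ 0 , a , c ⟫ (S-⟪⟫ 0 a c) ⟩
    iter (bump I) n (f₀ m (f₀ m ⟪ 0 , a , c ⟫))  ≡⟨ cong (iter (bump I) n ∘ f₀ m)
                                                      (F₀.stepⱼ 0 a c (nonzero-case (ρ₀ 0) (λ _ → refl) c≢0)) ⟩
    iter (bump I) n (f₀ m ⟪ 1 , a , c ⟫)         ≡⟨ cong (iter (bump I) n) (F₀.stepₖ 1 a c refl) ⟩
    iter (bump I) n ⟪ 2 , a , suc c ⟫            ≡⟨ iter-bumpᵢ n 2 a (suc c) ⟩
    ⟪ n + 2 , n + a , suc c ⟫                    ≡⟨ ⟪⟫-cong n+2≡ₘ0 ≡ₘ-refl ≡ₘ-refl ⟩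
    ⟪ 0 , n + a , suc c ⟫                        ∎

  f₀-round-k≡0 : ∀ a c → c % m ≡ 0 → R₀ ⟪ 0 , a , c ⟫ ≡ ⟪ 0 , n + suc a , suc c ⟫
  f₀-round-k≡0 a c c≡0 = begin
    R₀ ⟪ 0 , a , c ⟫                             ≡⟨ F₀.round (λ _ _ → refl) ⟪ 0 , a , c ⟫ (S-⟪⟫ 0 a c) ⟩
    iter (bump I) n (f₀ m (f₀ m ⟪ 0 , a , c ⟫))  ≡⟨ cong (iter (bump I) n ∘ f₀ m) (F₀.stepᵢ 0 a c (cong (ρ₀ 0) c≡0)) ⟩
    iter (bump I) n (f₀ m ⟪ 1 , suc a , c ⟫)     ≡⟨ cong (iter (bump I) n) (F₀.stepₖ 1 (suc a) c refl) ⟩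
    iter (bump I) n ⟪ 2 , suc a , suc c ⟫        ≡⟨ iter-bumpᵢ n 2 (suc a) (suc c) ⟩
    ⟪ n + 2 , n + suc a , suc c ⟫                ≡⟨ ⟪⟫-cong n+2≡ₘ0 ≡ₘ-refl ≡ₘ-refl ⟩
    ⟪ 0 , n + suc a , suc c ⟫                    ∎

  f₀-rounds : ∀ r a → r < m → iter R₀ r ⟪ 0 , a , 1 ⟫ ≡ ⟪ 0 , r * n + a , suc r ⟫
  f₀-rounds r a r<m = iter-along R₀ (λ u → ⟪ 0 , u * n + a , suc u ⟫) r λ {u} u<r →
    trans (f₀-round-k≢0 (u * n + a) (suc u) (suc-%-≢0 (≤-<-trans u<r r<m)))
          (cong (λ x → ⟪ 0 , x , suc (suc u) ⟫) (sym (+-assoc n (u * n) a)))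

  f₀-block : ∀ a → iter R₀ m ⟪ 0 , a , 1 ⟫ ≡ ⟪ 0 , suc a , 1 ⟫
  f₀-block a = begin
    R₀ (iter R₀ (suc n) ⟪ 0 , a , 1 ⟫)         ≡⟨ cong R₀ (f₀-rounds (suc n) a ≤-refl) ⟩
    R₀ ⟪ 0 , suc n * n + a , m ⟫               ≡⟨ f₀-round-k≡0 (suc n * n + a) m (n%n≡0 m) ⟩
    ⟪ 0 , n + suc (suc n * n + a) , suc m ⟫    ≡⟨ ⟪⟫-cong ≡ₘ-refl (multiple-≡ₘ n (identity a n)) (+m-≡ₘ 1) ⟩
    ⟪ 0 , suc a , 1 ⟫                          ∎
    where
    identity : ∀ a n → n + suc (suc n * n + a) ≡ suc a + n * suc (suc n)
    identity = solve-∀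

  f₀-blocks : ∀ q a → iter (iter R₀ m) q ⟪ 0 , a , 1 ⟫ ≡ ⟪ 0 , q + a , 1 ⟫
  f₀-blocks q a = iter-along (iter R₀ m) (λ q → ⟪ 0 , q + a , 1 ⟫) q (λ _ → f₀-block _)

  -- A block adds 1 to i and a round adds n ≡ -2, so 2r + a blocks and then r rounds give i ≡ a.
  f₀-reach : ∀ a c → c < m → SameCycle R₀ ⟪ 0 , 0 , 1 ⟫ ⟪ 0 , a , c ⟫
  f₀-reach a c c<m =
    let (r , r<m , 1+r≡c) = pred-≡ₘ c c<m
        q                 = 2 * r + a
    in  sameCycle-trans R₀ (sameCycle-iter R₀ m (q , f₀-blocks q 0))
          (r , trans (f₀-rounds r (q + 0) r<m) (⟪⟫-cong ≡ₘ-refl (multiple-≡ₘ r (identity r a n)) 1+r≡c))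
    where
    identity : ∀ r a n → r * n + (2 * r + a + 0) ≡ a + r * suc (suc n)
    identity = solve-∀

  f₀-single-cycle : HasCycleCount (f₀ m) 1
  f₀-single-cycle = F₀.hasOneCycle ⟪ 0 , 0 , 1 ⟫ (S-⟪⟫ 0 0 1) (F₀.predecessors uniform₀)
                                   (level0-ind (SameCycle R₀ ⟪ 0 , 0 , 1 ⟫) f₀-reach)

  module F₁ = FollowingRule {ρ₁} {f₁ m} follows₁

  R₁ : V m → V m
  R₁ = iter (f₁ m) m

  f₁-round-k+1≢0 : ∀ a c → suc c % m ≢ 0 → R₁ ⟪ 0 , a , c ⟫ ≡ ⟪ 0 , a , suc c ⟫
  f₁-round-k+1≢0 a c 1+c≢0 = begin
    R₁ ⟪ 0 , a , c ⟫                             ≡⟨ F₁.round (λ _ _ → refl) ⟪ 0 , a , c ⟫ (S-⟪⟫ 0 a c) ⟩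
    iter (bump J) n (f₁ m (f₁ m ⟪ 0 , a , c ⟫))  ≡⟨ cong (iter (bump J) n ∘ f₁ m) (F₁.stepₖ 0 a c refl) ⟩
    iter (bump J) n (f₁ m ⟪ 1 , a , suc c ⟫)     ≡⟨ cong (iter (bump J) n)
                                                      (F₁.stepⱼ 1 a (suc c) (nonzero-case (ρ₁ 1) (λ _ → refl) 1+c≢0)) ⟩
    iter (bump J) n ⟪ 2 , a , suc c ⟫            ≡⟨ iter-bumpⱼ n 2 a (suc c) ⟩
    ⟪ n + 2 , a , suc c ⟫                        ≡⟨ ⟪⟫-cong n+2≡ₘ0 ≡ₘ-refl ≡ₘ-refl ⟩
    ⟪ 0 , a , suc c ⟫                            ∎

  f₁-round-k+1≡0 : ∀ a c → suc c % m ≡ 0 → R₁ ⟪ 0 , a , c ⟫ ≡ ⟪ 0 , suc a , suc c ⟫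
  f₁-round-k+1≡0 a c 1+c≡0 = begin
    R₁ ⟪ 0 , a , c ⟫                             ≡⟨ F₁.round (λ _ _ → refl) ⟪ 0 , a , c ⟫ (S-⟪⟫ 0 a c) ⟩
    iter (bump J) n (f₁ m (f₁ m ⟪ 0 , a , c ⟫))  ≡⟨ cong (iter (bump J) n ∘ f₁ m) (F₁.stepₖ 0 a c refl) ⟩
    iter (bump J) n (f₁ m ⟪ 1 , a , suc c ⟫)     ≡⟨ cong (iter (bump J) n) (F₁.stepᵢ 1 a (suc c) (cong (ρ₁ 1) 1+c≡0)) ⟩
    iter (bump J) n ⟪ 2 , suc a , suc c ⟫        ≡⟨ iter-bumpⱼ n 2 (suc a) (suc c) ⟩
    ⟪ n + 2 , suc a , suc c ⟫                    ≡⟨ ⟪⟫-cong n+2≡ₘ0 ≡ₘ-refl ≡ₘ-refl ⟩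
    ⟪ 0 , suc a , suc c ⟫                        ∎

  f₁-rounds : ∀ r a → r < m → iter R₁ r ⟪ 0 , a , 0 ⟫ ≡ ⟪ 0 , a , r ⟫
  f₁-rounds r a r<m = iter-along R₁ (λ u → ⟪ 0 , a , u ⟫) r λ u<r →
    f₁-round-k+1≢0 a _ (suc-%-≢0 (≤-<-trans u<r r<m))

  f₁-block : ∀ a → iter R₁ m ⟪ 0 , a , 0 ⟫ ≡ ⟪ 0 , suc a , 0 ⟫
  f₁-block a = begin
    R₁ (iter R₁ (suc n) ⟪ 0 , a , 0 ⟫)  ≡⟨ cong R₁ (f₁-rounds (suc n) a ≤-refl) ⟩
    R₁ ⟪ 0 , a , suc n ⟫                ≡⟨ f₁-round-k+1≡0 a (suc n) (n%n≡0 m) ⟩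
    ⟪ 0 , suc a , m ⟫                   ≡⟨ ⟪⟫-cong ≡ₘ-refl ≡ₘ-refl (+m-≡ₘ 0) ⟩
    ⟪ 0 , suc a , 0 ⟫                   ∎

  f₁-blocks : ∀ q a → iter (iter R₁ m) q ⟪ 0 , a , 0 ⟫ ≡ ⟪ 0 , q + a , 0 ⟫
  f₁-blocks q a = iter-along (iter R₁ m) (λ q → ⟪ 0 , q + a , 0 ⟫) q (λ _ → f₁-block _)

  f₁-reach : ∀ a c → c < m → SameCycle R₁ ⟪ 0 , 0 , 0 ⟫ ⟪ 0 , a , c ⟫
  f₁-reach a c c<m =
    sameCycle-trans R₁ (sameCycle-iter R₁ m (a , f₁-blocks a 0))
      (c , trans (f₁-rounds c (a + 0) c<m) (cong (λ x → ⟪ 0 , x , c ⟫) (+-identityʳ a)))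

  f₁-single-cycle : HasCycleCount (f₁ m) 1
  f₁-single-cycle = F₁.hasOneCycle ⟪ 0 , 0 , 0 ⟫ (S-⟪⟫ 0 0 0) (F₁.predecessors uniform₁)
                                   (level0-ind (SameCycle R₁ ⟪ 0 , 0 , 0 ⟫) f₁-reach)

module EvenTorus (g : ℕ) where

  n : ℕ
  n = suc g * 2

  open Torus n
  open ≡-Reasoning

  [x%m]%2≡x%2 : ∀ x → x % m % 2 ≡ x % 2
  [x%m]%2≡x%2 x = m∣n⇒o%n%m≡o%m 2 m x (divides (suc (suc g)) refl)

  [n+x]%2≡x%2 : ∀ x → (n + x) % 2 ≡ x % 2
  [n+x]%2≡x%2 x = trans (cong (_% 2) (+-comm n x)) ([m+kn]%n≡m%n x (suc g) 2)

  odd-%-≢0 : ∀ {x} → x % 2 ≡ 1 → x % m ≢ 0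
  odd-%-≢0 {x} odd x%m≡0 = 0≢1+n (trans (cong (_% 2) (sym x%m≡0)) (trans ([x%m]%2≡x%2 x) odd))

  parity : ∀ x → x % 2 ≡ 0 ⊎ x % 2 ≡ 1
  parity x with x % 2 | m%n<n x 2
  ... | 0 | _                 = inj₁ refl
  ... | 1 | _                 = inj₂ refl
  ... | suc (suc _) | s≤s (s≤s ())

  module F₂ = FollowingRule {ρ₂} {f₂ m} follows₂

  -- Opaque because m = 4 + 2g is concrete here: unfolding the iterates of f₂ during
  -- conversion checking would take exponential time.
  opaque
    R₂ : V m → V m
    R₂ = iter (f₂ m) m

    R₂-unfold : ∀ v → R₂ v ≡ iter (f₂ m) m v
    R₂-unfold v = refl

  f₂-round-k≡0 : ∀ a c → c % m ≡ 0 → R₂ ⟪ 0 , a , c ⟫ ≡ ⟪ 0 , a , n + c ⟫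
  f₂-round-k≡0 a c c≡0 = begin
    R₂ ⟪ 0 , a , c ⟫                             ≡⟨ R₂-unfold ⟪ 0 , a , c ⟫ ⟩
    iter (f₂ m) m ⟪ 0 , a , c ⟫                  ≡⟨ F₂.round (λ _ _ → refl) ⟪ 0 , a , c ⟫ (S-⟪⟫ 0 a c) ⟩
    iter (bump K) n (f₂ m (f₂ m ⟪ 0 , a , c ⟫))  ≡⟨ cong (iter (bump K) n ∘ f₂ m) (F₂.stepⱼ 0 a c (cong (ρ₂ 0) c≡0)) ⟩
    iter (bump K) n (f₂ m ⟪ 1 , a , c ⟫)         ≡⟨ cong (iter (bump K) n) (F₂.stepⱼ 1 a c (cong (ρ₂ 1) c≡0)) ⟩
    iter (bump K) n ⟪ 2 , a , c ⟫                ≡⟨ iter-bumpₖ n 2 a c ⟩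
    ⟪ n + 2 , a , n + c ⟫                        ≡⟨ ⟪⟫-cong n+2≡ₘ0 ≡ₘ-refl ≡ₘ-refl ⟩
    ⟪ 0 , a , n + c ⟫                            ∎

  f₂-round-k≢0 : ∀ a c → c % m ≢ 0 → R₂ ⟪ 0 , a , c ⟫ ≡ ⟪ 0 , 2 + a , n + c ⟫
  f₂-round-k≢0 a c c≢0 = begin
    R₂ ⟪ 0 , a , c ⟫                             ≡⟨ R₂-unfold ⟪ 0 , a , c ⟫ ⟩
    iter (f₂ m) m ⟪ 0 , a , c ⟫                  ≡⟨ F₂.round (λ _ _ → refl) ⟪ 0 , a , c ⟫ (S-⟪⟫ 0 a c) ⟩
    iter (bump K) n (f₂ m (f₂ m ⟪ 0 , a , c ⟫))  ≡⟨ cong (iter (bump K) n ∘ f₂ m)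
                                                      (F₂.stepᵢ 0 a c (nonzero-case (ρ₂ 0) (λ _ → refl) c≢0)) ⟩
    iter (bump K) n (f₂ m ⟪ 1 , 1 + a , c ⟫)     ≡⟨ cong (iter (bump K) n)
                                                      (F₂.stepᵢ 1 (1 + a) c (nonzero-case (ρ₂ 1) (λ _ → refl) c≢0)) ⟩
    iter (bump K) n ⟪ 2 , 2 + a , c ⟫            ≡⟨ iter-bumpₖ n 2 (2 + a) c ⟩
    ⟪ n + 2 , 2 + a , n + c ⟫                    ≡⟨ ⟪⟫-cong n+2≡ₘ0 ≡ₘ-refl ≡ₘ-refl ⟩
    ⟪ 0 , 2 + a , n + c ⟫                        ∎

  f₂-rounds : ∀ r a c → (∀ {u} → u < r → (u * n + c) % m ≢ 0) →
              iter R₂ r ⟪ 0 , a , c ⟫ ≡ ⟪ 0 , r * 2 + a , r * n + c ⟫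
  f₂-rounds r a c k≢0 = iter-along R₂ (λ u → ⟪ 0 , u * 2 + a , u * n + c ⟫) r λ {u} u<r →
    trans (f₂-round-k≢0 (u * 2 + a) (u * n + c) (k≢0 u<r))
          (cong₂ (λ x y → ⟪ 0 , x , y ⟫) (sym (+-assoc 2 (u * 2) a)) (sym (+-assoc n (u * n) c)))

  multiple-of-n-≢0 : ∀ {u} → u < suc g → (u * n + n) % m ≢ 0
  multiple-of-n-≢0 {u} u<1+g with m≤n⇒∃[o]m+o≡n (s≤s⁻¹ u<1+g)
  ... | w , u+w≡g = λ u*n+n≡0 → suc-%-≢0 2+2w<m (trans (sym (%-≡ (multiple-≡ₘ u identity))) u*n+n≡0)
    where
    polynomial : ∀ u w → u * (suc (u + w) * 2) + suc (u + w) * 2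
                         ≡ 2 + w * 2 + u * suc (suc (suc (u + w) * 2))
    polynomial = solve-∀
    identity : u * n + n ≡ 2 + w * 2 + u * m
    identity = subst (λ G → u * (suc G * 2) + suc G * 2 ≡ 2 + w * 2 + u * suc (suc (suc G * 2)))
                     u+w≡g (polynomial u w)
    2+2w<m : 2 + w * 2 < m
    2+2w<m = s≤s (s≤s (s≤s (m≤n⇒m≤1+n (*-monoˡ-≤ 2 (subst (w ≤_) u+w≡g (m≤n+m w u))))))

  odd-rounds-≢0 : ∀ u → (u * n + suc n) % m ≢ 0
  odd-rounds-≢0 u = odd-%-≢0 {u * n + suc n}
    (trans (cong (_% 2) (identity u g)) ([m+kn]%n≡m%n 1 (u * suc g + suc g) 2))
    where
    identity : ∀ u g → u * (suc g * 2) + suc (suc g * 2) ≡ 1 + (u * suc g + suc g) * 2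
    identity = solve-∀

  f₂-block : ∀ a → iter R₂ (suc (suc g)) ⟪ 0 , a , n ⟫ ≡ ⟪ 0 , n + a , n ⟫
  f₂-block a = begin
    R₂ (iter R₂ (suc g) ⟪ 0 , a , n ⟫)   ≡⟨ cong R₂ (f₂-rounds (suc g) a n multiple-of-n-≢0) ⟩
    R₂ ⟪ 0 , n + a , suc g * n + n ⟫     ≡⟨ f₂-round-k≡0 (n + a) _ (%-≡ (multiple-≡ₘ {y = 0} (suc g) (identity g))) ⟩
    ⟪ 0 , n + a , n + (suc g * n + n) ⟫  ≡⟨ ⟪⟫-cong ≡ₘ-refl ≡ₘ-refl (multiple-≡ₘ (suc g) (identity′ g)) ⟩
    ⟪ 0 , n + a , n ⟫                    ∎
    where
    identity : ∀ g → suc g * (suc g * 2) + suc g * 2 ≡ 0 + suc g * suc (suc (suc g * 2))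
    identity = solve-∀
    identity′ : ∀ g → suc g * 2 + (suc g * (suc g * 2) + suc g * 2)
                      ≡ suc g * 2 + suc g * suc (suc (suc g * 2))
    identity′ = solve-∀

  f₂-blocks : ∀ q a → iter (iter R₂ (suc (suc g))) q ⟪ 0 , a , n ⟫ ≡ ⟪ 0 , q * n + a , n ⟫
  f₂-blocks q a = iter-along (iter R₂ (suc (suc g))) (λ q → ⟪ 0 , q * n + a , n ⟫) q λ {q} _ →
    trans (f₂-block (q * n + a)) (cong (λ x → ⟪ 0 , x , n ⟫) (sym (+-assoc n (q * n) a)))

  repOdd : Fin m → V m
  repOdd x = ⟪ 0 , suc (toℕ x) , suc n ⟫

  repEven : Fin 2 → V m
  repEven p = ⟪ 0 , toℕ p , n ⟫

  rep : Fin (m + 2) → V m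
  rep idx = [ repOdd , repEven ]′ (splitAt m idx)

  -- Invariants of R₂ on level 0: for odd k the sum i + k (i.e. -j), for even k the
  -- parity of i; the two even orbits get the indices m and m + 1.
  classOf : ℕ → ℕ → ℕ
  classOf a c with c % 2
  ... | zero  = m + a % 2
  ... | suc _ = (a + c) % m

  orbitIndex : V m → ℕ
  orbitIndex v = classOf (toℕ (coordᵢ v)) (toℕ (coordₖ v))

  orbitIndex-⟪⟫ : ∀ t a c → orbitIndex ⟪ t , a , c ⟫ ≡ classOf (a % m) (c % m)
  orbitIndex-⟪⟫ t a c = cong₂ classOf (trans (cong toℕ (coordᵢ-⟪⟫ t a c)) (toℕ-mod a))
                                      (trans (cong toℕ (coordₖ-⟪⟫ t a c)) (toℕ-mod c))

  classOf-even : ∀ a c → c % 2 ≡ 0 → classOf a c ≡ m + a % 2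
  classOf-even a c c-even rewrite c-even = refl

  classOf-odd : ∀ a c → c % 2 ≡ 1 → classOf a c ≡ (a + c) % m
  classOf-odd a c c-odd rewrite c-odd = refl

  classOf-cong : ∀ {a a′ c c′} → a % 2 ≡ a′ % 2 → c % 2 ≡ c′ % 2 → (c % 2 ≡ 1 → a + c ≡ₘ a′ + c′) →
                 classOf (a % m) (c % m) ≡ classOf (a′ % m) (c′ % m)
  classOf-cong {a} {a′} {c} {c′} a≡ c≡ odd⇒ with parity c
  ... | inj₁ even = begin
    classOf (a % m) (c % m)    ≡⟨ classOf-even (a % m) (c % m) (trans ([x%m]%2≡x%2 c) even) ⟩
    m + a % m % 2              ≡⟨ cong (m +_) (trans ([x%m]%2≡x%2 a) (trans a≡ (sym ([x%m]%2≡x%2 a′)))) ⟩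
    m + a′ % m % 2             ≡⟨ classOf-even (a′ % m) (c′ % m) (trans ([x%m]%2≡x%2 c′) (trans (sym c≡) even)) ⟨
    classOf (a′ % m) (c′ % m)  ∎
  ... | inj₂ odd = begin
    classOf (a % m) (c % m)    ≡⟨ classOf-odd (a % m) (c % m) (trans ([x%m]%2≡x%2 c) odd) ⟩
    (a % m + c % m) % m        ≡⟨ %-≡ (≡ₘ-trans (+-cong-≡ₘ (%-≡ₘ a) (%-≡ₘ c))
                                        (≡ₘ-trans (odd⇒ odd) (≡ₘ-sym (+-cong-≡ₘ (%-≡ₘ a′) (%-≡ₘ c′))))) ⟩
    (a′ % m + c′ % m) % m      ≡⟨ classOf-odd (a′ % m) (c′ % m) (trans ([x%m]%2≡x%2 c′) (trans (sym c≡) odd)) ⟨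
    classOf (a′ % m) (c′ % m)  ∎

  orbitIndex-invariant : ∀ v → S m v ≡ 0 → orbitIndex (R₂ v) ≡ orbitIndex v
  orbitIndex-invariant = level0-ind (λ v → orbitIndex (R₂ v) ≡ orbitIndex v) invariant
    where
    identity : ∀ a c n → 2 + a + (n + c) ≡ a + c + 1 * suc (suc n)
    identity = solve-∀
    invariant : ∀ a c → c < m → orbitIndex (R₂ ⟪ 0 , a , c ⟫) ≡ orbitIndex ⟪ 0 , a , c ⟫
    invariant a c _ with c % m ≟ 0
    ... | yes c≡0 = begin
      orbitIndex (R₂ ⟪ 0 , a , c ⟫)  ≡⟨ cong orbitIndex (f₂-round-k≡0 a c c≡0) ⟩
      orbitIndex ⟪ 0 , a , n + c ⟫   ≡⟨ orbitIndex-⟪⟫ 0 a (n + c) ⟩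
      classOf (a % m) ((n + c) % m)  ≡⟨ classOf-cong {a} {a} {n + c} {c} refl ([n+x]%2≡x%2 c)
                                          (λ odd → contradiction c≡0
                                                     (odd-%-≢0 {c} (trans (sym ([n+x]%2≡x%2 c)) odd))) ⟩
      classOf (a % m) (c % m)        ≡⟨ orbitIndex-⟪⟫ 0 a c ⟨
      orbitIndex ⟪ 0 , a , c ⟫       ∎
    ... | no c≢0 = begin
      orbitIndex (R₂ ⟪ 0 , a , c ⟫)      ≡⟨ cong orbitIndex (f₂-round-k≢0 a c c≢0) ⟩
      orbitIndex ⟪ 0 , 2 + a , n + c ⟫   ≡⟨ orbitIndex-⟪⟫ 0 (2 + a) (n + c) ⟩
      classOf ((2 + a) % m) ((n + c) % m) ≡⟨ classOf-cong {2 + a} {a} {n + c} {c} refl ([n+x]%2≡x%2 c)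
                                                (λ _ → multiple-≡ₘ 1 (identity a c n)) ⟩
      classOf (a % m) (c % m)            ≡⟨ orbitIndex-⟪⟫ 0 a c ⟨
      orbitIndex ⟪ 0 , a , c ⟫           ∎

  rep-↑ˡ : ∀ x → rep (x ↑ˡ 2) ≡ repOdd x
  rep-↑ˡ x = cong [ repOdd , repEven ]′ (splitAt-↑ˡ m x 2)

  rep-↑ʳ : ∀ p → rep (m ↑ʳ p) ≡ repEven p
  rep-↑ʳ p = cong [ repOdd , repEven ]′ (splitAt-↑ʳ m 2 p)

  rep-level : ∀ idx → S m (rep idx) ≡ 0
  rep-level idx with splitAt m idx
  ... | inj₁ x = S-⟪⟫ 0 _ _
  ... | inj₂ p = S-⟪⟫ 0 _ _

  rep-index : ∀ idx → orbitIndex (rep idx) ≡ toℕ idx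
  rep-index idx with splitAt m idx in eq
  ... | inj₁ x = begin
    orbitIndex ⟪ 0 , suc (toℕ x) , suc n ⟫  ≡⟨ orbitIndex-⟪⟫ 0 (suc (toℕ x)) (suc n) ⟩
    classOf (suc (toℕ x) % m) (suc n % m)   ≡⟨ classOf-odd (suc (toℕ x) % m) (suc n % m)
                                                 (trans ([x%m]%2≡x%2 (suc n)) ([m+kn]%n≡m%n 1 (suc g) 2)) ⟩
    (suc (toℕ x) % m + suc n % m) % m       ≡⟨ ≡ₘ-value (≡ₘ-trans (+-cong-≡ₘ (%-≡ₘ (suc (toℕ x))) (%-≡ₘ (suc n)))
                                                                (multiple-≡ₘ 1 (identity (toℕ x) n))) (toℕ<n x) ⟩
    toℕ x                                   ≡⟨ toℕ-↑ˡ x 2 ⟨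
    toℕ (x ↑ˡ 2)                            ≡⟨ cong toℕ (splitAt⁻¹-↑ˡ eq) ⟩
    toℕ idx                                 ∎
    where
    identity : ∀ x n → suc x + suc n ≡ x + 1 * suc (suc n)
    identity = solve-∀
  ... | inj₂ p = begin
    orbitIndex ⟪ 0 , toℕ p , n ⟫            ≡⟨ orbitIndex-⟪⟫ 0 (toℕ p) n ⟩
    classOf (toℕ p % m) (n % m)             ≡⟨ classOf-even (toℕ p % m) (n % m)
                                                 (trans ([x%m]%2≡x%2 n) (m*n%n≡0 (suc g) 2)) ⟩
    m + toℕ p % m % 2                       ≡⟨ cong (m +_) (trans ([x%m]%2≡x%2 (toℕ p)) (m<n⇒m%n≡m (toℕ<n p))) ⟩
    m + toℕ p                               ≡⟨ toℕ-↑ʳ m p ⟨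
    toℕ (m ↑ʳ p)                            ≡⟨ cong toℕ (splitAt⁻¹-↑ʳ eq) ⟩
    toℕ idx                                 ∎

  -- A round adds n ≡ -2 to k, so w = g + 1 - u rounds take k from n + 1 to 1 + 2u, and from
  -- n to 2u. The identities are polynomial once suc g is replaced by u + w.
  odd-orbit : ∀ a u w → u + w ≡ suc g →
              SameCycle R₂ (repOdd ((a + (1 + u * 2)) mod m)) ⟪ 0 , a , 1 + u * 2 ⟫
  odd-orbit a u w u+w≡1+g = w , (begin
    iter R₂ w ⟪ 0 , suc t , suc n ⟫        ≡⟨ f₂-rounds w (suc t) (suc n) (λ {u} _ → odd-rounds-≢0 u) ⟩
    ⟪ 0 , w * 2 + suc t , w * n + suc n ⟫  ≡⟨ ⟪⟫-cong ≡ₘ-refl i≡ k≡ ⟩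
    ⟪ 0 , a , 1 + u * 2 ⟫                  ∎)
    where
    t : ℕ
    t = toℕ ((a + (1 + u * 2)) mod m)
    polynomialᵢ : ∀ a u w → w * 2 + suc (a + (1 + u * 2)) ≡ a + 1 * suc (suc ((u + w) * 2))
    polynomialᵢ = solve-∀
    polynomialₖ : ∀ u w → w * ((u + w) * 2) + suc ((u + w) * 2) ≡ 1 + u * 2 + w * suc (suc ((u + w) * 2))
    polynomialₖ = solve-∀
    i≡ : w * 2 + suc t ≡ₘ a
    i≡ = ≡ₘ-trans (+-cong-≡ₘ (≡ₘ-refl {w * 2}) (+-cong-≡ₘ (≡ₘ-refl {1})
                    (≡ₘ-trans (≡ₘ-reflexive (toℕ-mod (a + (1 + u * 2)))) (%-≡ₘ (a + (1 + u * 2))))))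
                  (multiple-≡ₘ 1 (subst (λ G → w * 2 + suc (a + (1 + u * 2)) ≡ a + 1 * suc (suc (G * 2)))
                                        u+w≡1+g (polynomialᵢ a u w)))
    k≡ : w * n + suc n ≡ₘ 1 + u * 2
    k≡ = multiple-≡ₘ w (subst (λ G → w * (G * 2) + suc (G * 2) ≡ 1 + u * 2 + w * suc (suc (G * 2)))
                              u+w≡1+g (polynomialₖ u w))

  -- A block adds n ≡ -2 to i, which the q blocks use to cancel the 2w added by the rounds.
  even-orbit : ∀ a u w → u + w ≡ suc g → SameCycle R₂ (repEven (a mod 2)) ⟪ 0 , a , u * 2 ⟫
  even-orbit a u w u+w≡1+g =
    sameCycle-trans R₂ (sameCycle-iter R₂ (suc (suc g)) (q , f₂-blocks q p)) (w , rounds)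
    where
    p q : ℕ
    p = toℕ (a mod 2)
    q = w + a / 2 * suc g
    polynomialᵢ : ∀ w v g p → w * 2 + ((w + v * suc g) * (suc g * 2) + p)
                              ≡ p + v * 2 + (w + v * g) * suc (suc (suc g * 2))
    polynomialᵢ = solve-∀
    polynomialₖ : ∀ u w → w * ((u + w) * 2) + (u + w) * 2 ≡ u * 2 + w * suc (suc ((u + w) * 2))
    polynomialₖ = solve-∀
    i≡ : w * 2 + (q * n + p) ≡ₘ a
    i≡ = ≡ₘ-trans (multiple-≡ₘ (w + a / 2 * g) (polynomialᵢ w (a / 2) g p))
                  (≡ₘ-reflexive (trans (cong (_+ a / 2 * 2) (toℕ-fromℕ< (m%n<n a 2)))
                                       (sym (m≡m%n+[m/n]*n a 2))))
    k≡ : w * n + n ≡ₘ u * 2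
    k≡ = multiple-≡ₘ w (subst (λ G → w * (G * 2) + G * 2 ≡ u * 2 + w * suc (suc (G * 2)))
                              u+w≡1+g (polynomialₖ u w))
    w≤1+g : w ≤ suc g
    w≤1+g = subst (w ≤_) u+w≡1+g (m≤n+m w u)
    rounds : iter R₂ w ⟪ 0 , q * n + p , n ⟫ ≡ ⟪ 0 , a , u * 2 ⟫
    rounds = trans (f₂-rounds w (q * n + p) n (λ u<w → multiple-of-n-≢0 (<-≤-trans u<w w≤1+g)))
                   (⟪⟫-cong ≡ₘ-refl i≡ k≡)

  reach : ∀ v → S m v ≡ 0 → ∃ λ idx → SameCycle R₂ (rep idx) v
  reach = level0-ind (λ v → ∃ λ idx → SameCycle R₂ (rep idx) v) reach-⟪⟫
    where
    reach-⟪⟫ : ∀ a c → c < m → ∃ λ idx → SameCycle R₂ (rep idx) ⟪ 0 , a , c ⟫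
    reach-⟪⟫ a c c<m with m≤n⇒∃[o]m+o≡n (s≤s⁻¹ (m<n*o⇒m/o<n {n = suc (suc g)} c<m))
    ... | w , u+w≡1+g = subst (λ c → ∃ λ idx → SameCycle R₂ (rep idx) ⟪ 0 , a , c ⟫)
                              (sym (m≡m%n+[m/n]*n c 2)) (by-parity (parity c))
      where
      u : ℕ
      u = c / 2
      by-parity : c % 2 ≡ 0 ⊎ c % 2 ≡ 1 → ∃ λ idx → SameCycle R₂ (rep idx) ⟪ 0 , a , c % 2 + u * 2 ⟫
      by-parity (inj₁ even) rewrite even =
        m ↑ʳ (a mod 2) ,
        subst (λ x → SameCycle R₂ x ⟪ 0 , a , u * 2 ⟫) (sym (rep-↑ʳ (a mod 2))) (even-orbit a u w u+w≡1+g)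
      by-parity (inj₂ odd) rewrite odd =
        ((a + (1 + u * 2)) mod m) ↑ˡ 2 ,
        subst (λ x → SameCycle R₂ x ⟪ 0 , a , 1 + u * 2 ⟫) (sym (rep-↑ˡ _)) (odd-orbit a u w u+w≡1+g)

  f₂-cycles : HasCycleCount (f₂ m) (m + 2)
  f₂-cycles = F₂.hasCycleCount rep orbitIndex rep-level rep-index
    (λ v lv → trans (cong orbitIndex (sym (R₂-unfold v))) (orbitIndex-invariant v lv))
    (F₂.predecessors uniform₂)
    (λ v lv → let (idx , rep→v) = reach v lv in idx , sameCycle-cong R₂ R₂-unfold rep→v)

proposition3p6 : (m : ℕ) → .{{_ : NonZero m}} → 4 ≤ m → 2 ∣ m →
    HasCycleCount (f₀ m) 1 × HasCycleCount (f₁ m) 1 × HasCycleCount (f₂ m) (m + 2)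
proposition3p6 .(0 * 2)               ()                 (divides 0 refl)
proposition3p6 .(1 * 2)               (s≤s (s≤s ()))     (divides 1 refl)
proposition3p6 .(suc (suc g) * 2)     _                  (divides (suc (suc g)) refl) =
  Torus.f₀-single-cycle (suc g * 2) , Torus.f₁-single-cycle (suc g * 2) , EvenTorus.f₂-cycles g
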